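{- Let $k,\ell\ge0$, let $T$ be a set of $t$ positive integers, and let $\pi=\pi_0\pi_1\cdots\pi_t$ with $\pi_0=0$ and $\pi_1\cdots\pi_t$ a permutation of $T$. For $1\le v\le t$, let $\mathrm{Pref}(\pi_v)$ be the set of $a\in[t]$ such that a car with preference $a$, arriving at a street with spots $0,1,\dots,t$ in which spot $0$ is empty and, for $u\ge 1$, spot $u$ is occupied exactly when $\pi_u<\pi_v$, parks in spot $v$ under the $(k,\ell)$-pullback rule. Then $|\mathrm{Pref}(\pi_v)|=\mathrm{B}(\pi_v)+\mathrm{F}(\pi_v)+1$, where $\mathrm{B}(\pi_v)=\min(\mathrm{Right}(\pi_v),k)$ and $\mathrm{F}(\pi_v)=\max(\min(\mathrm{Left}(\pi_v)-k,\ell),0)$.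
   Context: $(k,\ell)$-pullback parking rule: a car with preference $a$ parks in spot $a$ if it is empty; otherwise it checks spots $a-1,\dots,a-k$ in order (not below spot $0$) and parks in the first empty one; if none, it checks spots $a+1,\dots,a+\ell$ in order (not beyond spot $t$) and parks in the first empty one; otherwise it fails. $\mathrm{Right}(\pi_v)$ is the largest $x\ge0$ with $\pi_y<\pi_v$ for all $v+1\le y\le v+x\le t$; $\mathrm{Left}(\pi_v)$ is the largest $x\ge0$ with $0<\pi_z<\pi_v$ for all $1\le v-x\le z\le v-1$. -}

module Defs where

open import Data.Nat using (ℕ; zero; suc; _+_; _∸_; _≤_; _<_; _<ᵇ_; _≤ᵇ_)
open import Data.Nat.Properties using (_≟_)
open import Data.Bool using (Bool; true; false; if_then_else_; not)
open import Data.Maybe using (Maybe; just; nothing)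
open import Data.Maybe.Properties using (≡-dec)
open import Data.List using (List; filter; length; map; upTo)
open import Data.Product using (_×_)
open import Relation.Nullary using (Dec)
open import Relation.Binary.PropositionalEquality using (_≡_)

-- A street state: occupied u = true iff spot u is occupied.
Street : Set
Street = ℕ → Bool

backSearch : Street → (a k : ℕ) → Maybe ℕ
backSearch occ zero    k       = nothing
backSearch occ (suc a) zero    = nothing
backSearch occ (suc a) (suc k) = if occ a then backSearch occ a k else just a

fwdSearch : Street → (t a ℓ : ℕ) → Maybe ℕ
fwdSearch occ t a zero    = nothing
fwdSearch occ t a (suc ℓ) =
  if suc a ≤ᵇ t
  then (if occ (suc a) then fwdSearch occ t (suc a) ℓ else just (suc a))
  else nothing

pullback : (k ℓ t : ℕ) → Street → (a : ℕ) → Maybe ℕ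
pullback k ℓ t occ a with occ a
... | false = just a
... | true with backSearch occ a k
...   | just s  = just s
...   | nothing = fwdSearch occ t a ℓ

streetFor : (π : ℕ → ℕ) (v : ℕ) → Street
streetFor π v zero    = false
streetFor π v (suc u) = π (suc u) <ᵇ π v

range1 : ℕ → List ℕ
range1 t = map suc (upTo t)

-- Pref(π_v) as a list of preferences a ∈ [t] (listed increasingly, no repeats)
Pref : (k ℓ t : ℕ) (π : ℕ → ℕ) (v : ℕ) → List ℕ
Pref k ℓ t π v =
  filter (λ a → ≡-dec _≟_ (pullback k ℓ t (streetFor π v) a) (just v)) (range1 t)

RightProp : (t : ℕ) (π : ℕ → ℕ) (v x : ℕ) → Set
RightProp t π v x = (v + x ≤ t) × (∀ y → suc v ≤ y → y ≤ v + x → π y < π v)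

IsRight : (t : ℕ) (π : ℕ → ℕ) (v x : ℕ) → Set
IsRight t π v x = RightProp t π v x × (∀ x' → RightProp t π v x' → x' ≤ x)

LeftProp : (π : ℕ → ℕ) (v x : ℕ) → Set
LeftProp π v x = (x < v) × (∀ z → v ∸ x ≤ z → z ≤ v ∸ 1 → (0 < π z) × (π z < π v))

IsLeft : (π : ℕ → ℕ) (v x : ℕ) → Set
IsLeft π v x = LeftProp π v x × (∀ x' → LeftProp π v x' → x' ≤ x)

-- Seen from the car for π_v, spot v is vacant, the Right(π_v) spots after it are occupied and
-- the next one is vacant (or beyond t), and the Left(π_v) spots before it are occupied with a
-- vacant spot (possibly spot 0) just before them.  A car preferring a > v reaches v only by its
-- backward search, which runs through occupied spots down to v iff a ≤ v + min(Right, k).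
-- A car preferring a < v must first fail its backward search, i.e. the vacant spot before the
-- left run lies more than k behind a, and then reach v forwards within ℓ steps; together this
-- is v - a ≤ min(Left - k, ℓ).  So Pref(π_v) is the interval [v - F, v + B], which lies in [t].
module Submission where

open import Defs
open import Data.Bool using (true; false)
open import Data.Bool.Properties using (T-≡; ¬-not)
open import Data.List using ([]; _∷_; _++_; length; filter; applyUpTo)
open import Data.List.Properties
  using (filter-++; filter-none; filter-all; ++-identityʳ; map-upTo; length-applyUpTo)
open import Data.List.Relation.Unary.All using (All)
open import Data.List.Relation.Unary.All.Properties using (applyUpTo⁺₁)
open import Data.Maybe using (just; nothing; _<∣>_)
open import Data.Maybe.Properties using (just-injective; ≡-dec)
open import Data.Nat using (ℕ; zero; suc; _+_; _∸_; _⊓_; _≤_; _<_; s≤s; s≤s⁻¹; z<s; _≤ᵇ_; _≤?_)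
open import Data.Nat.Properties
open import Data.Nat.Tactic.RingSolver using (solve)
open import Data.Product using (_×_; _,_; proj₁; proj₂; ∃-syntax; uncurry)
open import Data.Sum using (inj₁; inj₂)
open import Function.Base using (_∘_)
open import Function.Bundles using (Equivalence; _⇔_; mk⇔)
open import Relation.Binary using (tri<; tri≈; tri>)
open import Relation.Binary.PropositionalEquality
open import Relation.Nullary using (¬_; contradiction; yes; no)
open import Relation.Unary using (Decidable)

Occupied Vacant : Street → ℕ → Set
Occupied occ j = occ j ≡ true
Vacant   occ j = occ j ≡ false

module SearchProperties (occ : Street) where

  vacant⇒¬occupied : ∀ {j} → Vacant occ j → ¬ Occupied occ j
  vacant⇒¬occupied vacant occupied with () ← trans (sym vacant) occupied

  occupied-upTo : ∀ {s a} → Occupied occ a → (∀ j → s < j → j < a → Occupied occ j) →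
                  ∀ j → s < j → j ≤ a → Occupied occ j
  occupied-upTo oa between j s<j j≤a with m≤n⇒m<n∨m≡n j≤a
  ... | inj₁ j<a  = between j s<j j<a
  ... | inj₂ refl = oa

  occupied-from : ∀ {a s} → Occupied occ a → (∀ j → a < j → j < s → Occupied occ j) →
                  ∀ j → a ≤ j → j < s → Occupied occ j
  occupied-from oa between j a≤j j<s with m≤n⇒m<n∨m≡n a≤j
  ... | inj₁ a<j  = between j a<j j<s
  ... | inj₂ refl = oa

  backSearch-just : ∀ a k {s} → backSearch occ a k ≡ just s →
    s < a × a ≤ s + k × Vacant occ s × (∀ j → s < j → j < a → Occupied occ j)
  backSearch-just (suc a) (suc k) eq with occ a in oa
  backSearch-just (suc a) (suc k) refl | false =
    n<1+n a , subst (suc a ≤_) (sym (+-suc a k)) (s≤s (m≤m+n a k)) , oa ,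
    λ j a<j j<1+a → contradiction (m<1+n⇒m≤n j<1+a) (<⇒≱ a<j)
  ... | true with backSearch-just a k eq
  ...   | s<a , a≤s+k , vacant , between =
    m<n⇒m<1+n s<a , subst (suc a ≤_) (sym (+-suc _ k)) (s≤s a≤s+k) , vacant ,
    λ j s<j j<1+a → occupied-upTo oa between j s<j (m<1+n⇒m≤n j<1+a)

  backSearch-nothing : ∀ a k → backSearch occ a k ≡ nothing →
    ∀ j → j < a → a ≤ j + k → Occupied occ j
  backSearch-nothing (suc a) zero eq j j<a a≤j+0 =
    contradiction (subst (suc a ≤_) (+-identityʳ j) a≤j+0) (<⇒≱ j<a)
  backSearch-nothing (suc a) (suc k) eq j j<1+a 1+a≤j+1+k with occ a in oa
  ... | true with m<1+n⇒m<n∨m≡n j<1+a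
  ...   | inj₁ j<a  = backSearch-nothing a k eq j j<a (≤-pred (subst (suc a ≤_) (+-suc j k) 1+a≤j+1+k))
  ...   | inj₂ refl = oa

  fwdSearch-just : ∀ t a ℓ {s} → fwdSearch occ t a ℓ ≡ just s →
    a < s × s ≤ a + ℓ × s ≤ t × Vacant occ s × (∀ j → a < j → j < s → Occupied occ j)
  fwdSearch-just t a (suc ℓ) {s} eq with suc a ≤ᵇ t in a<t
  ... | true with occ (suc a) in oa
  fwdSearch-just t a (suc ℓ) refl | true | false =
    n<1+n a , subst (suc a ≤_) (sym (+-suc a ℓ)) (s≤s (m≤m+n a ℓ)) ,
    ≤ᵇ⇒≤ (suc a) t (Equivalence.from T-≡ a<t) , oa ,
    λ j a<j j<1+a → contradiction (m<1+n⇒m≤n j<1+a) (<⇒≱ a<j)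
  ...   | true with fwdSearch-just t (suc a) ℓ eq
  ...     | a<s , s≤a+ℓ , s≤t , vacant , between =
    <-trans (n<1+n a) a<s , subst (s ≤_) (sym (+-suc a ℓ)) s≤a+ℓ , s≤t , vacant ,
    occupied-from oa between

  fwdSearch-nothing : ∀ t a ℓ → fwdSearch occ t a ℓ ≡ nothing →
    ∀ j → a < j → j ≤ a + ℓ → j ≤ t → Occupied occ j
  fwdSearch-nothing t a zero eq j a<j j≤a+0 j≤t =
    contradiction (subst (j ≤_) (+-identityʳ a) j≤a+0) (<⇒≱ a<j)
  fwdSearch-nothing t a (suc ℓ) eq j a<j j≤a+1+ℓ j≤t with suc a ≤ᵇ t in a<t
  ... | false = contradiction (trans (sym (Equivalence.to T-≡ (≤⇒≤ᵇ (<-≤-trans a<j j≤t)))) a<t) λ ()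
  ... | true with occ (suc a) in oa
  ...   | true with m≤n⇒m<n∨m≡n a<j
  ...     | inj₁ 1+a<j = fwdSearch-nothing t (suc a) ℓ eq j 1+a<j (subst (j ≤_) (+-suc a ℓ) j≤a+1+ℓ) j≤t
  ...     | inj₂ refl = oa

  backSearch-hit : ∀ {a k s} → Vacant occ s → s < a → a ≤ s + k →
    (∀ j → s < j → j < a → Occupied occ j) → backSearch occ a k ≡ just s
  backSearch-hit {a} {k} {s} vacant s<a a≤s+k between with backSearch occ a k in eq
  ... | nothing = contradiction (backSearch-nothing a k eq s s<a a≤s+k) (vacant⇒¬occupied vacant)
  ... | just s′ with backSearch-just a k eq
  ...   | s′<a , _ , vacant′ , between′ with <-cmp s s′
  ...     | tri< s<s′ _ _ = contradiction (between s′ s<s′ s′<a) (vacant⇒¬occupied vacant′)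
  ...     | tri≈ _ refl _ = refl
  ...     | tri> _ _ s′<s = contradiction (between′ s s′<s s<a) (vacant⇒¬occupied vacant)

  backSearch-miss : ∀ {a k} → (∀ j → j < a → a ≤ j + k → Occupied occ j) → backSearch occ a k ≡ nothing
  backSearch-miss {a} {k} window with backSearch occ a k in eq
  ... | nothing = refl
  ... | just s with backSearch-just a k eq
  ...   | s<a , a≤s+k , vacant , _ = contradiction (window s s<a a≤s+k) (vacant⇒¬occupied vacant)

  fwdSearch-hit : ∀ {t a ℓ s} → Vacant occ s → a < s → s ≤ a + ℓ → s ≤ t →
    (∀ j → a < j → j < s → Occupied occ j) → fwdSearch occ t a ℓ ≡ just s
  fwdSearch-hit {t} {a} {ℓ} {s} vacant a<s s≤a+ℓ s≤t between with fwdSearch occ t a ℓ in eq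
  ... | nothing = contradiction (fwdSearch-nothing t a ℓ eq s a<s s≤a+ℓ s≤t) (vacant⇒¬occupied vacant)
  ... | just s′ with fwdSearch-just t a ℓ eq
  ...   | a<s′ , _ , _ , vacant′ , between′ with <-cmp s s′
  ...     | tri< s<s′ _ _ = contradiction (between′ s a<s s<s′) (vacant⇒¬occupied vacant)
  ...     | tri≈ _ refl _ = refl
  ...     | tri> _ _ s′<s = contradiction (between s′ a<s′ s′<s) (vacant⇒¬occupied vacant′)

module PullbackProperties (k ℓ t : ℕ) (occ : Street) where
  open SearchProperties occ

  pullback-vacant : ∀ {a} → Vacant occ a → pullback k ℓ t occ a ≡ just a
  pullback-vacant {a} vacant with occ a
  ... | false = refl

  pullback-occupied : ∀ {a} → Occupied occ a →
    pullback k ℓ t occ a ≡ (backSearch occ a k <∣> fwdSearch occ t a ℓ)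
  pullback-occupied {a} occupied with occ a
  ... | true with backSearch occ a k
  ...   | just _  = refl
  ...   | nothing = refl

  pullback-below : ∀ {a s} → pullback k ℓ t occ a ≡ just s → s < a →
    a ≤ s + k × (∀ j → s < j → j ≤ a → Occupied occ j)
  pullback-below {a} eq s<a with occ a in oa
  ... | false = contradiction (just-injective eq) (>⇒≢ s<a)
  ... | true with backSearch occ a k in eb
  ...   | nothing = contradiction (proj₁ (fwdSearch-just t a ℓ eq)) (<⇒≯ s<a)
  ...   | just _ with refl ← eq with backSearch-just a k eb
  ...     | _ , a≤s+k , _ , between = a≤s+k , occupied-upTo oa between

  pullback-above : ∀ {a s} → pullback k ℓ t occ a ≡ just s → a < s →
    s ≤ a + ℓ × (∀ j → a ≤ j → j < s → Occupied occ j) × (∀ j → j < a → a ≤ j + k → Occupied occ j)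
  pullback-above {a} eq a<s with occ a in oa
  ... | false = contradiction (just-injective eq) (<⇒≢ a<s)
  ... | true with backSearch occ a k in eb
  ...   | just _ with refl ← eq = contradiction (proj₁ (backSearch-just a k eb)) (<⇒≯ a<s)
  ...   | nothing with fwdSearch-just t a ℓ eq
  ...     | _ , s≤a+ℓ , _ , _ , between =
    s≤a+ℓ , occupied-from oa between , backSearch-nothing a k eb

  pullback-hit-below : ∀ {a s} → Vacant occ s → s < a → a ≤ s + k →
    (∀ j → s < j → j ≤ a → Occupied occ j) → pullback k ℓ t occ a ≡ just s
  pullback-hit-below {a} vacant s<a a≤s+k run = begin
    pullback k ℓ t occ a                        ≡⟨ pullback-occupied (run a s<a ≤-refl) ⟩
    backSearch occ a k <∣> fwdSearch occ t a ℓ  ≡⟨ cong (_<∣> _) (backSearch-hit vacant s<a a≤s+k between) ⟩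
    just _                                      ∎
    where
    open ≡-Reasoning
    between : ∀ j → _ < j → j < a → Occupied occ j
    between j s<j j<a = run j s<j (<⇒≤ j<a)

  pullback-hit-above : ∀ {a s} → Vacant occ s → a < s → s ≤ a + ℓ → s ≤ t →
    (∀ j → a ≤ j → j < s → Occupied occ j) → (∀ j → j < a → a ≤ j + k → Occupied occ j) →
    pullback k ℓ t occ a ≡ just s
  pullback-hit-above {a} vacant a<s s≤a+ℓ s≤t run window = begin
    pullback k ℓ t occ a                        ≡⟨ pullback-occupied (run a ≤-refl a<s) ⟩
    backSearch occ a k <∣> fwdSearch occ t a ℓ
      ≡⟨ cong₂ _<∣>_ (backSearch-miss window) (fwdSearch-hit vacant a<s s≤a+ℓ s≤t between) ⟩
    just _                                      ∎
    where
    open ≡-Reasoning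
    between : ∀ j → a < j → j < _ → Occupied occ j
    between j a<j = run j (<⇒≤ a<j)

record Runs (t : ℕ) (occ : Street) (v r l : ℕ) : Set where
  field
    vacant      : Vacant occ v
    right-run   : ∀ j → v < j → j ≤ v + r → Occupied occ j
    right-bound : v + r ≤ t
    right-end   : suc (v + r) ≤ t → Vacant occ (suc (v + r))
    left-run    : ∀ j → j < v → v ≤ j + l → Occupied occ j
    left-end    : ∃[ p ] p + suc l ≡ v × Vacant occ p

+-⊓-glb : ∀ {m} n {o p} → m ≤ n + o → m ≤ n + p → m ≤ n + o ⊓ p
+-⊓-glb n m≤n+o m≤n+p = subst (_ ≤_) (sym (+-distribˡ-⊓ n _ _)) (⊓-glb m≤n+o m≤n+p)

≤+⊓⇒≤+ˡ : ∀ {m} n {o p} → m ≤ n + o ⊓ p → m ≤ n + o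
≤+⊓⇒≤+ˡ n m≤n+o⊓p = ≤-trans m≤n+o⊓p (+-monoʳ-≤ n (m⊓n≤m _ _))

≤+⊓⇒≤+ʳ : ∀ {m} n {o p} → m ≤ n + o ⊓ p → m ≤ n + p
≤+⊓⇒≤+ʳ n m≤n+o⊓p = ≤-trans m≤n+o⊓p (+-monoʳ-≤ n (m⊓n≤n _ _))

module _ {t : ℕ} {occ : Street} {v r l : ℕ} (runs : Runs t occ v r l) where
  open Runs runs
  open SearchProperties occ

  right-run-bound : ∀ {a} → a ≤ t → (∀ j → v < j → j ≤ a → Occupied occ j) → a ≤ v + r
  right-run-bound {a} a≤t run with a ≤? v + r
  ... | yes a≤v+r = a≤v+r
  ... | no a≰v+r = contradiction (run (suc (v + r)) (s≤s (m≤m+n v r)) v+r<a)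
                                 (vacant⇒¬occupied (right-end (<-≤-trans v+r<a a≤t)))
    where
    v+r<a : v + r < a
    v+r<a = ≰⇒> a≰v+r

  left-run-bound : ∀ {a k} → (∀ j → a ≤ j → j < v → Occupied occ j) →
    (∀ j → j < a → a ≤ j + k → Occupied occ j) → v ≤ a + (l ∸ k)
  left-run-bound {a} {k} run window with left-end
  ... | p , p+1+l≡v , p-vacant = begin
    v                       ≡⟨ sym p+1+l≡v ⟩
    p + suc l               ≡⟨ +-suc p l ⟩
    suc (p + l)             ≤⟨ s≤s (+-monoʳ-≤ p (m≤n+m∸n l k)) ⟩
    suc (p + (k + (l ∸ k))) ≡⟨ cong suc (+-assoc p k (l ∸ k)) ⟨
    suc (p + k) + (l ∸ k)   ≤⟨ +-monoˡ-≤ (l ∸ k) p+k<a ⟩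
    a + (l ∸ k)             ∎
    where
    open ≤-Reasoning
    p<a : p < a
    p<a = ≰⇒> λ a≤p → vacant⇒¬occupied p-vacant (run p a≤p (subst (p <_) p+1+l≡v (m<m+n p z<s)))
    p+k<a : p + k < a
    p+k<a = ≰⇒> λ a≤p+k → vacant⇒¬occupied p-vacant (window p p<a a≤p+k)

  module _ (k ℓ : ℕ) where
    open PullbackProperties k ℓ t occ

    parks-at⇒window : ∀ {a} → a ≤ t → pullback k ℓ t occ a ≡ just v →
      v ≤ a + (l ∸ k) ⊓ ℓ × a ≤ v + r ⊓ k
    parks-at⇒window {a} a≤t parks with <-cmp a v
    ... | tri≈ _ refl _ = m≤m+n a _ , m≤m+n a _
    ... | tri> _ _ v<a with pullback-below parks v<a
    ...   | a≤v+k , run = ≤-trans (<⇒≤ v<a) (m≤m+n a _) , +-⊓-glb v (right-run-bound a≤t run) a≤v+k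
    parks-at⇒window {a} a≤t parks | tri< a<v _ _ with pullback-above parks a<v
    ...   | v≤a+ℓ , run , window =
      +-⊓-glb a (left-run-bound run window) v≤a+ℓ , ≤-trans (<⇒≤ a<v) (m≤m+n v _)

    window⇒parks-at : ∀ {a} → v ≤ a + (l ∸ k) ⊓ ℓ → a ≤ v + r ⊓ k → pullback k ℓ t occ a ≡ just v
    window⇒parks-at {a} v≤a+F a≤v+B with <-cmp a v
    ... | tri≈ _ refl _ = pullback-vacant vacant
    ... | tri> _ _ v<a = pullback-hit-below vacant v<a (≤+⊓⇒≤+ʳ v a≤v+B)
                           (λ j v<j j≤a → right-run j v<j (≤-trans j≤a (≤+⊓⇒≤+ˡ v a≤v+B)))
    ... | tri< a<v _ _ = pullback-hit-above vacant a<v (≤+⊓⇒≤+ʳ a v≤a+F) (≤-trans (m≤m+n v r) right-bound)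
                           (λ j a≤j j<v → left-run j j<v (≤-trans v≤a+l (+-monoˡ-≤ l a≤j)))
                           (λ j j<a a≤j+k → left-run j (<-trans j<a a<v) (v≤j+l a≤j+k))
      where
      open ≤-Reasoning
      v≤a+l : v ≤ a + l
      v≤a+l = ≤-trans (≤+⊓⇒≤+ˡ a v≤a+F) (+-monoʳ-≤ a (m∸n≤m l k))
      k≤l : k ≤ l
      k≤l = <⇒≤ (m∸n≢0⇒n<m λ l∸k≡0 → <⇒≱ a<v (begin
        v           ≤⟨ ≤+⊓⇒≤+ˡ a v≤a+F ⟩
        a + (l ∸ k) ≡⟨ cong (a +_) l∸k≡0 ⟩
        a + 0       ≡⟨ +-identityʳ a ⟩
        a           ∎))
      v≤j+l : ∀ {j} → a ≤ j + k → v ≤ j + l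
      v≤j+l {j} a≤j+k = begin
        v                 ≤⟨ ≤+⊓⇒≤+ˡ a v≤a+F ⟩
        a + (l ∸ k)       ≤⟨ +-monoˡ-≤ (l ∸ k) a≤j+k ⟩
        j + k + (l ∸ k)   ≡⟨ +-assoc j k (l ∸ k) ⟩
        j + (k + (l ∸ k)) ≡⟨ cong (j +_) (m+[n∸m]≡n k≤l) ⟩
        j + l             ∎

module _ (π : ℕ → ℕ) (v : ℕ) where

  streetFor-occupied : ∀ j → 0 < j → π j < π v → Occupied (streetFor π v) j
  streetFor-occupied (suc j) _ πj<πv = Equivalence.to T-≡ (<⇒<ᵇ πj<πv)

  occupied-streetFor : ∀ j → Occupied (streetFor π v) j → π j < π v
  occupied-streetFor (suc j) occupied = <ᵇ⇒< _ _ (Equivalence.from T-≡ occupied)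

  streetFor-vacant : ∀ j → ¬ π j < π v → Vacant (streetFor π v) j
  streetFor-vacant j πj≮πv = ¬-not (πj≮πv ∘ occupied-streetFor j)

module _ {π : ℕ → ℕ} {v x : ℕ} where

  leftProp⇒run : LeftProp π (suc v) x → ∀ z → z < suc v → suc v ≤ z + x → 0 < π z × π z < π (suc v)
  leftProp⇒run (_ , within) z z<1+v 1+v≤z+x =
    within z (m≤n+o⇒m∸n≤o (suc v) x (subst (suc v ≤_) (+-comm z x) 1+v≤z+x)) (m<1+n⇒m≤n z<1+v)

  run⇒leftProp : x < suc v → (∀ z → z < suc v → suc v ≤ z + x → 0 < π z × π z < π (suc v)) →
    LeftProp π (suc v) x
  run⇒leftProp x<1+v run = x<1+v , λ z 1+v∸x≤z z≤v → run z (s≤s z≤v) (begin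
    suc v             ≤⟨ m≤n+m∸n (suc v) x ⟩
    x + (suc v ∸ x)   ≤⟨ +-monoʳ-≤ x 1+v∸x≤z ⟩
    x + z             ≡⟨ +-comm x z ⟩
    z + x             ∎)
    where open ≤-Reasoning

streetFor-runs : ∀ {t r l} (π : ℕ → ℕ) → π 0 ≡ 0 → (∀ u → 1 ≤ u → u ≤ t → 0 < π u) →
  ∀ v → IsRight t π v r → IsLeft π v l → Runs t (streetFor π v) v r l
streetFor-runs π _ _ zero _ ((() , _) , _)
streetFor-runs {t} {r} {l} π π0≡0 positive v@(suc _) ((v+r≤t , right) , right-max) (left , left-max) = record
  { vacant      = streetFor-vacant π v v (<-irrefl refl)
  ; right-run   = λ j v<j j≤v+r → streetFor-occupied π v j (<-trans z<s v<j) (right j v<j j≤v+r)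
  ; right-bound = v+r≤t
  ; right-end   = right-end
  ; left-run    = λ j j<v v≤j+l → left-occupied j (leftProp⇒run left j j<v v≤j+l)
  ; left-end    = v ∸ suc l , m∸n+n≡m (proj₁ left) , left-end-vacant (v ∸ suc l) (m∸n+n≡m (proj₁ left))
  }
  where
  right-end : suc (v + r) ≤ t → Vacant (streetFor π v) (suc (v + r))
  right-end 1+v+r≤t = streetFor-vacant π v (suc (v + r)) λ πe<πv →
    1+n≰n (right-max (suc r) (subst (_≤ t) (sym (+-suc v r)) 1+v+r≤t , extended πe<πv))
    where
    extended : π (suc (v + r)) < π v → ∀ y → suc v ≤ y → y ≤ v + suc r → π y < π v
    extended πe<πv y v<y y≤v+1+r with m≤n⇒m<n∨m≡n (subst (y ≤_) (+-suc v r) y≤v+1+r)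
    ... | inj₁ y<1+v+r = right y v<y (m<1+n⇒m≤n y<1+v+r)
    ... | inj₂ refl    = πe<πv

  left-occupied : ∀ j → 0 < π j × π j < π v → Occupied (streetFor π v) j
  left-occupied zero    (0<π0 , _)    = contradiction (subst (0 <_) π0≡0 0<π0) λ ()
  left-occupied (suc j) (_ , πj<πv) = streetFor-occupied π v (suc j) z<s πj<πv

  left-end-vacant : ∀ p → p + suc l ≡ v → Vacant (streetFor π v) p
  left-end-vacant zero      _        = refl
  left-end-vacant p@(suc _) p+1+l≡v = streetFor-vacant π v p λ πp<πv →
    1+n≰n (left-max (suc l) (run⇒leftProp 1+l<v (extended πp<πv)))
    where
    1+l<v : suc l < v
    1+l<v = subst (suc l <_) p+1+l≡v (m<n+m (suc l) z<s)
    p≤t : p ≤ t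
    p≤t = ≤-trans (subst (p ≤_) p+1+l≡v (m≤m+n p (suc l))) (≤-trans (m≤m+n v r) v+r≤t)
    extended : π p < π v → ∀ z → z < v → v ≤ z + suc l → 0 < π z × π z < π v
    extended πp<πv z z<v v≤z+1+l with m≤n⇒m<n∨m≡n v≤z+1+l
    ... | inj₁ v<z+1+l = leftProp⇒run left z z<v (m<1+n⇒m≤n (subst (v <_) (+-suc z l) v<z+1+l))
    ... | inj₂ v≡z+1+l with refl ← +-cancelʳ-≡ (suc l) z p (trans (sym v≡z+1+l) (sym p+1+l≡v)) =
      positive p z<s p≤t , πp<πv

applyUpTo-+ : ∀ {A : Set} (f : ℕ → A) m n → applyUpTo f (m + n) ≡ applyUpTo f m ++ applyUpTo (f ∘ (m +_)) n
applyUpTo-+ f zero    n = refl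
applyUpTo-+ f (suc m) n = cong (f 0 ∷_) (applyUpTo-+ (f ∘ suc) m n)

module _ {A : Set} {P : A → Set} (P? : Decidable P) where

  filter-middle : ∀ {xs ys zs} → All (¬_ ∘ P) xs → All P ys → All (¬_ ∘ P) zs →
    filter P? (xs ++ ys ++ zs) ≡ ys
  filter-middle {xs} {ys} {zs} none-xs all-ys none-zs = begin
    filter P? (xs ++ ys ++ zs)             ≡⟨ filter-++ P? xs (ys ++ zs) ⟩
    filter P? xs ++ filter P? (ys ++ zs)   ≡⟨ cong₂ _++_ (filter-none P? none-xs) (filter-++ P? ys zs) ⟩
    filter P? ys ++ filter P? zs           ≡⟨ cong₂ _++_ (filter-all P? all-ys) (filter-none P? none-zs) ⟩
    ys ++ []                               ≡⟨ ++-identityʳ ys ⟩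
    ys                                     ∎
    where open ≡-Reasoning

module _ {P : ℕ → Set} (P? : Decidable P) where

  length-filter-range1 : ∀ c n d → (∀ {a} → a ≤ c + (n + d) → P a ⇔ (c < a × a ≤ c + n)) →
    length (filter P? (range1 (c + (n + d)))) ≡ n
  length-filter-range1 c n d interval = begin
    length (filter P? (range1 (c + (n + d))))
      ≡⟨ cong (length ∘ filter P?) split ⟩
    length (filter P? (applyUpTo suc c ++ applyUpTo (suc ∘ (c +_)) n ++ applyUpTo (suc ∘ (c +_) ∘ (n +_)) d))
      ≡⟨ cong length (filter-middle P? (applyUpTo⁺₁ _ c before) (applyUpTo⁺₁ _ n inside)
                                       (applyUpTo⁺₁ _ d after)) ⟩
    length (applyUpTo (suc ∘ (c +_)) n)
      ≡⟨ length-applyUpTo _ n ⟩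
    n ∎
    where
    open ≡-Reasoning
    split : range1 (c + (n + d)) ≡
            applyUpTo suc c ++ applyUpTo (suc ∘ (c +_)) n ++ applyUpTo (suc ∘ (c +_) ∘ (n +_)) d
    split = begin
      range1 (c + (n + d))                                ≡⟨ map-upTo suc (c + (n + d)) ⟩
      applyUpTo suc (c + (n + d))                         ≡⟨ applyUpTo-+ suc c (n + d) ⟩
      applyUpTo suc c ++ applyUpTo (suc ∘ (c +_)) (n + d)
        ≡⟨ cong (applyUpTo suc c ++_) (applyUpTo-+ (suc ∘ (c +_)) n d) ⟩
      applyUpTo suc c ++ applyUpTo (suc ∘ (c +_)) n ++ applyUpTo (suc ∘ (c +_) ∘ (n +_)) d ∎
    before : ∀ {i} → i < c → ¬ P (suc i)
    before {i} i<c Pa = <⇒≱ i<c (s≤s⁻¹ (proj₁ (Equivalence.to (interval (≤-trans i<c (m≤m+n c _))) Pa)))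
    inside : ∀ {i} → i < n → P (suc (c + i))
    inside {i} i<n =
      Equivalence.from (interval (≤-trans a≤c+n (+-monoʳ-≤ c (m≤m+n n d)))) (s≤s (m≤m+n c i) , a≤c+n)
      where
      a≤c+n : suc (c + i) ≤ c + n
      a≤c+n = subst (_≤ c + n) (+-suc c i) (+-monoʳ-≤ c i<n)
    after : ∀ {i} → i < d → ¬ P (suc (c + (n + i)))
    after {i} i<d Pa = <⇒≱ c+n<a (proj₂ (Equivalence.to (interval a≤t) Pa))
      where
      c+n<a : c + n < suc (c + (n + i))
      c+n<a = s≤s (+-monoʳ-≤ c (m≤m+n n i))
      a≤t : suc (c + (n + i)) ≤ c + (n + d)
      a≤t = subst (_≤ c + (n + d)) (trans (cong (c +_) (+-suc n i)) (+-suc c (n + i)))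
              (+-monoʳ-≤ c (+-monoʳ-≤ n i<d))

  length-filter-window : ∀ {t v F B} → F < v → v + B ≤ t →
    (∀ {a} → a ≤ t → P a ⇔ (v ≤ a + F × a ≤ v + B)) → length (filter P? (range1 t)) ≡ B + F + 1
  length-filter-window {t} {v} {F} {B} F<v v+B≤t window with v ∸ suc F | m∸n+n≡m F<v
  ... | c | refl with t ∸ (c + suc F + B) | m∸n+n≡m v+B≤t
  ...   | d | refl = begin
    length (filter P? (range1 (d + (c + suc F + B)))) ≡⟨ cong (length ∘ filter P? ∘ range1) t≡c+n+d ⟩
    length (filter P? (range1 (c + (n + d))))         ≡⟨ length-filter-range1 c n d interval ⟩
    n                                                 ∎
    where
    open ≡-Reasoning
    n : ℕ
    n = B + F + 1
    t≡c+n+d : d + (c + suc F + B) ≡ c + (B + F + 1 + d)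
    t≡c+n+d = solve (d ∷ c ∷ F ∷ B ∷ [])
    v+B≡c+n : c + suc F + B ≡ c + (B + F + 1)
    v+B≡c+n = solve (c ∷ F ∷ B ∷ [])
    interval : ∀ {a} → a ≤ c + (n + d) → P a ⇔ (c < a × a ≤ c + n)
    interval {a} a≤c+n+d = mk⇔
      (λ Pa → let v≤a+F , a≤v+B = Equivalence.to (window a≤t) Pa in
        +-cancelʳ-≤ F (suc c) a (subst (_≤ a + F) (+-suc c F) v≤a+F) , subst (a ≤_) v+B≡c+n a≤v+B)
      (λ (c<a , a≤c+n) → Equivalence.from (window a≤t)
        (subst (_≤ a + F) (sym (+-suc c F)) (+-monoˡ-≤ F c<a) , subst (a ≤_) (sym v+B≡c+n) a≤c+n))
      where
      a≤t : a ≤ d + (c + suc F + B)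
      a≤t = subst (a ≤_) (sym t≡c+n+d) a≤c+n+d

corollary3p8 : (k ℓ t : ℕ) (π : ℕ → ℕ) →
    π 0 ≡ 0 →
    (∀ u → 1 ≤ u → u ≤ t → 0 < π u) →
    (∀ u w → 1 ≤ u → u ≤ t → 1 ≤ w → w ≤ t → π u ≡ π w → u ≡ w) →
    (v : ℕ) → 1 ≤ v → v ≤ t →
    (r l : ℕ) → IsRight t π v r → IsLeft π v l →
    length (Pref k ℓ t π v) ≡ (r ⊓ k) + ((l ∸ k) ⊓ ℓ) + 1
corollary3p8 k ℓ t π π0≡0 positive _ v _ _ r l right left =
  length-filter-window (λ a → ≡-dec _≟_ (pullback k ℓ t (streetFor π v) a) (just v)) F<v v+B≤t
    (λ a≤t → mk⇔ (parks-at⇒window runs k ℓ a≤t) (uncurry (window⇒parks-at runs k ℓ)))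
  where
  runs : Runs t (streetFor π v) v r l
  runs = streetFor-runs π π0≡0 positive v right left
  F<v : (l ∸ k) ⊓ ℓ < v
  F<v = ≤-<-trans (≤-trans (m⊓n≤m _ _) (m∸n≤m l k)) (proj₁ (proj₁ left))
  v+B≤t : v + r ⊓ k ≤ t
  v+B≤t = ≤-trans (+-monoʳ-≤ v (m⊓n≤m r k)) (proj₁ (proj₁ right))
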